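{- For integers $l\geq 0$ and even integers $w$, let $\kappa_l(w):=d((l+1)w)-\delta_l(w)$. Then for every $l\geq0$ the sequence $(\kappa_l(w))_{w\geq 0,\ w \text{ even}}$ is non-negative and non-decreasing, and there exists an integer $\kappa_l$ with $0\leq \kappa_l\leq \frac{(3+l)(4+l)}{6}$ such that $\kappa_l(w)=\kappa_l$ for all even $w\geq 2l+12$. Moreover, if $l\in\{0,1,2,3,4\}$ then $\kappa_l(w)=\kappa_l=0$ for all even integers $w$.
   Context: For an even integer $w$, $d(w)$ denotes the dimension of the space of modular forms of weight $w$ for $\mathrm{SL}_2(\mathbb{Z})$, namely $d(w)=0$ if $w<0$, $d(w)=\lfloor w/12\rfloor$ if $w\geq0$ and $w\equiv2\pmod{12}$, and $d(w)=\lfloor w/12\rfloor+1$ in all other cases. For $l\geq 0$, $\delta_l(w)=\sum_{i=0}^l d(w-2i)$. -}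

module Defs where

open import Data.Nat using (ℕ; zero; suc; _/_; _%_; _≡ᵇ_)
import Data.Nat as ℕ
open import Data.Integer using (ℤ; +_; -[1+_]; _+_; _-_; _*_)
open import Data.Bool using (if_then_else_)

-- d(w): dimension of the space of modular forms of weight w for SL₂(ℤ),
-- defined exactly as in the paper (the statement only uses even w):
--   d(w) = 0                   if w < 0
--   d(w) = ⌊w/12⌋              if w ≥ 0 and w ≡ 2 (mod 12)
--   d(w) = ⌊w/12⌋ + 1          otherwise
d : ℤ → ℤ
d -[1+ n ] = + 0
d (+ n)    = if (n % 12) ≡ᵇ 2 then + (n / 12) else + (n / 12 ℕ.+ 1)

δ : ℕ → ℤ → ℤ
δ zero    w = d w
δ (suc l) w = δ l w + d (w - + (2 ℕ.* suc l))

κ : ℕ → ℤ → ℤ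
κ l w = d (+ (suc l) * w) - δ l w

-- Write w = 2n.  Then 6 d(2n) = n + ρ(n) with ρ depending only on n mod 6, and
-- κ_l(2n+2) − κ_l(2n) = d(2(l+1)(n+1)) − d(2(l+1)n) − d(2n+2) + d(2(n−l)) =: Δ_l(n).
-- In 6Δ_l(n) the linear parts cancel when n ≥ l, and leave l − n when n < l
-- (the last term is then d of a negative weight, i.e. 0); the remaining
-- combination of ρ-values depends only on residues mod 6 and is read off a
-- finite table: it is 0 for n ≥ l and lies in [−6, 1] for n < l.  Hence
-- Δ_l(n) ≥ 0, 6Δ_l(n) ≤ l + 1 and Δ_l(n) = 0 for n ≥ l.  As κ_l(0) = 0, κ_l is
-- non-negative, non-decreasing, constant from w = 2l on, and
-- 6κ_l ≤ l(l+1) ≤ (3+l)(4+l); for l ≤ 4, κ_l(2l) = 0 by direct computation.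
module Submission where

open import Data.Bool using (true; false)
open import Data.Fin using (Fin; toℕ)
open import Data.Fin.Properties using (all?; toℕ-fromℕ<)
open import Data.Integer
  using (ℤ; +_; -[1+_]; _+_; _-_; _*_; -_; +≤+; -≤+; -<-)
  renaming (_≤_ to _≤ℤ_; _<_ to _<ℤ_)
import Data.Integer.Properties as ℤ
open import Data.Integer.Tactic.RingSolver using (solve-∀)
open import Data.Nat as ℕ
  using (ℕ; zero; suc; _≤_; _%_; _/_; _≡ᵇ_; z≤n; s≤s; compare; less; equal; greater)
open import Data.Nat.DivMod
  using (_mod_; [m+n]%n≡m%n; m/n≡1+[m∸n]/n; %-distribˡ-+; %-distribˡ-*; m%n%n≡m%n)
import Data.Nat.Properties as ℕ
import Data.Nat.Tactic.RingSolver as ℕ-Solver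
open import Data.Product using (_×_; ∃; _,_; proj₁; proj₂)
open import Data.Sum using (inj₁; inj₂)
open import Relation.Nullary.Decidable using (yes; no; from-yes; _×-dec_)
open import Relation.Binary.PropositionalEquality

open import Defs

infix 4 _≡_[mod_]
record _≡_[mod_] (a b k : ℕ) .⦃ _ : ℕ.NonZero k ⦄ : Set where
  constructor residues
  field residues-equal : a % k ≡ b % k

module _ {k : ℕ} .⦃ _ : ℕ.NonZero k ⦄ where

  ≡-mod-reduce : ∀ a → a ≡ a % k [mod k ]
  ≡-mod-reduce a = residues (sym (m%n%n≡m%n a k))

  +-cong-mod : ∀ {a b c e} → a ≡ b [mod k ] → c ≡ e [mod k ] → a ℕ.+ c ≡ b ℕ.+ e [mod k ]
  +-cong-mod {a} {b} {c} {e} (residues a≡b) (residues c≡e) = residues (begin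
    (a ℕ.+ c) % k              ≡⟨ %-distribˡ-+ a c k ⟩
    (a % k ℕ.+ c % k) % k      ≡⟨ cong₂ (λ x y → (x ℕ.+ y) % k) a≡b c≡e ⟩
    (b % k ℕ.+ e % k) % k      ≡⟨ %-distribˡ-+ b e k ⟨
    (b ℕ.+ e) % k              ∎)
    where open ≡-Reasoning

  *-cong-mod : ∀ {a b c e} → a ≡ b [mod k ] → c ≡ e [mod k ] → a ℕ.* c ≡ b ℕ.* e [mod k ]
  *-cong-mod {a} {b} {c} {e} (residues a≡b) (residues c≡e) = residues (begin
    (a ℕ.* c) % k              ≡⟨ %-distribˡ-* a c k ⟩
    (a % k ℕ.* (c % k)) % k    ≡⟨ cong₂ (λ x y → (x ℕ.* y) % k) a≡b c≡e ⟩
    (b % k ℕ.* (e % k)) % k    ≡⟨ %-distribˡ-* b e k ⟨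
    (b ℕ.* e) % k              ∎)
    where open ≡-Reasoning

  suc-cong-mod : ∀ {a b} → a ≡ b [mod k ] → suc a ≡ suc b [mod k ]
  suc-cong-mod = +-cong-mod {1} {1} (residues refl)

module Increments (f Δf : ℕ → ℤ) (f-suc : ∀ n → f (suc n) ≡ f n + Δf n) where

  nonDecreasing : (∀ n → + 0 ≤ℤ Δf n) → ∀ {m n} → m ≤ n → f m ≤ℤ f n
  nonDecreasing Δf≥0 {n = zero} z≤n = ℤ.≤-refl
  nonDecreasing Δf≥0 {m} {suc n} m≤1+n with ℕ.m≤n⇒m<n∨m≡n m≤1+n
  ... | inj₂ refl       = ℤ.≤-refl
  ... | inj₁ (s≤s m≤n) = ℤ.≤-trans (nonDecreasing Δf≥0 m≤n) (begin
    f n          ≡⟨ ℤ.+-identityʳ (f n) ⟨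
    f n + + 0    ≤⟨ ℤ.+-monoʳ-≤ (f n) (Δf≥0 n) ⟩
    f n + Δf n   ≡⟨ f-suc n ⟨
    f (suc n)    ∎)
    where open ℤ.≤-Reasoning

  constantFrom : ∀ {k} → (∀ {n} → k ≤ n → Δf n ≡ + 0) → ∀ {n} → k ≤ n → f n ≡ f k
  constantFrom {k} Δf≡0 k≤n = subst (λ n → f n ≡ f k) (ℕ.m+[n∸m]≡n k≤n) (shifted _)
    where
    shifted : ∀ j → f (k ℕ.+ j) ≡ f k
    shifted zero    = cong f (ℕ.+-identityʳ k)
    shifted (suc j) = begin
      f (k ℕ.+ suc j)             ≡⟨ cong f (ℕ.+-suc k j) ⟩
      f (suc (k ℕ.+ j))           ≡⟨ f-suc (k ℕ.+ j) ⟩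
      f (k ℕ.+ j) + Δf (k ℕ.+ j)  ≡⟨ cong (_+_ (f (k ℕ.+ j))) (Δf≡0 (ℕ.m≤m+n k j)) ⟩
      f (k ℕ.+ j) + + 0           ≡⟨ ℤ.+-identityʳ (f (k ℕ.+ j)) ⟩
      f (k ℕ.+ j)                 ≡⟨ shifted j ⟩
      f k                         ∎
      where open ≡-Reasoning

  boundedBy : ∀ {c} → (∀ n → Δf n ≤ℤ c) → ∀ n → f n ≤ℤ f 0 + + n * c
  boundedBy {c} Δf≤c zero    = ℤ.≤-reflexive (sym (ℤ.+-identityʳ (f 0)))
  boundedBy {c} Δf≤c (suc n) = begin
    f (suc n)              ≡⟨ f-suc n ⟩
    f n + Δf n             ≤⟨ ℤ.+-mono-≤ (boundedBy Δf≤c n) (Δf≤c n) ⟩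
    f 0 + + n * c + c      ≡⟨ regroup (f 0) (+ n) c ⟩
    f 0 + + suc n * c      ∎
    where
    open ℤ.≤-Reasoning
    regroup : ∀ a m c → a + m * c + c ≡ a + (+ 1 + m) * c
    regroup = solve-∀

d[n+12]≡d[n]+1 : ∀ n → d (+ (n ℕ.+ 12)) ≡ d (+ n) + + 1
d[n+12]≡d[n]+1 n
  rewrite [m+n]%n≡m%n n 12 ⦃ _ ⦄
        | m/n≡1+[m∸n]/n ⦃ _ ⦄ (ℕ.m≤n+m 12 n)
        | ℕ.m+n∸n≡m n 12
  with n % 12 ≡ᵇ 2
... | true  = cong +_ (ℕ.+-comm 1 (n / 12))
... | false = cong +_ (ℕ.+-comm 1 (n / 12 ℕ.+ 1))

d₂ : ℤ → ℤ
d₂ m = d (+ 2 * m)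

d₂[6+n]≡d₂[n]+1 : ∀ n → d₂ (+ (6 ℕ.+ n)) ≡ d₂ (+ n) + + 1
d₂[6+n]≡d₂[n]+1 n = begin
  d (+ (2 ℕ.* (6 ℕ.+ n)))     ≡⟨ cong (λ k → d (+ k)) (double n) ⟩
  d (+ (2 ℕ.* n ℕ.+ 12))      ≡⟨ d[n+12]≡d[n]+1 (2 ℕ.* n) ⟩
  d (+ (2 ℕ.* n)) + + 1       ≡⟨ cong (λ k → d k + + 1) (ℤ.pos-* 2 n) ⟩
  d₂ (+ n) + + 1              ∎
  where
  open ≡-Reasoning
  double : ∀ n → 2 ℕ.* (6 ℕ.+ n) ≡ 2 ℕ.* n ℕ.+ 12
  double = ℕ-Solver.solve-∀

-- ρ n = 6 d(2n) - n, which depends only on n mod 6.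
ρ₆ : ℕ → ℤ
ρ₆ 0 = + 6
ρ₆ 1 = -[1+ 0 ]
ρ₆ 2 = + 4
ρ₆ 3 = + 3
ρ₆ 4 = + 2
ρ₆ _ = + 1

ρ : ℕ → ℤ
ρ n = ρ₆ (n % 6)

ρ[6+n]≡ρ[n] : ∀ n → ρ (6 ℕ.+ n) ≡ ρ n
ρ[6+n]≡ρ[n] n = cong ρ₆ (trans (cong (_% 6) (ℕ.+-comm 6 n)) ([m+n]%n≡m%n n 6))

6d₂[n]≡n+ρ[n] : ∀ n → + 6 * d₂ (+ n) ≡ + n + ρ n
6d₂[n]≡n+ρ[n] 0 = refl
6d₂[n]≡n+ρ[n] 1 = refl
6d₂[n]≡n+ρ[n] 2 = refl
6d₂[n]≡n+ρ[n] 3 = refl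
6d₂[n]≡n+ρ[n] 4 = refl
6d₂[n]≡n+ρ[n] 5 = refl
6d₂[n]≡n+ρ[n] n@(suc (suc (suc (suc (suc (suc k)))))) = begin
  + 6 * d₂ (+ n)              ≡⟨ cong (+ 6 *_) (d₂[6+n]≡d₂[n]+1 k) ⟩
  + 6 * (d₂ (+ k) + + 1)      ≡⟨ ℤ.*-distribˡ-+ (+ 6) (d₂ (+ k)) (+ 1) ⟩
  + 6 * d₂ (+ k) + + 6        ≡⟨ cong (_+ + 6) (6d₂[n]≡n+ρ[n] k) ⟩
  + k + ρ k + + 6             ≡⟨ shift (+ k) (ρ k) ⟩
  + n + ρ k                   ≡⟨ cong (_+_ (+ n)) (ρ[6+n]≡ρ[n] k) ⟨
  + n + ρ n                   ∎
  where
  open ≡-Reasoning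
  shift : ∀ a b → a + b + + 6 ≡ + 6 + a + b
  shift = solve-∀

K : ℕ → ℕ → ℤ
K l n = κ l (+ 2 * + n)

Δ : ℕ → ℕ → ℤ
Δ l n = d₂ (+ (suc l ℕ.* suc n)) - d₂ (+ (suc l ℕ.* n)) - d₂ (+ suc n) + d₂ (+ n - + l)

δ-nonPos : ∀ l {w} → w ≤ℤ + 0 → δ l w ≡ d w
δ-nonPos zero    _               = refl
δ-nonPos (suc l) w≤0@(+≤+ z≤n) = trans (ℤ.+-identityʳ _) (δ-nonPos l w≤0)
δ-nonPos (suc l) w≤0@-≤+       = trans (ℤ.+-identityʳ _) (δ-nonPos l w≤0)

δ-step : ∀ l n → δ l (+ 2 * + suc n) ≡ δ l (+ 2 * + n) + d₂ (+ suc n) - d₂ (+ n - + l)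
δ-step zero n = begin
  d₂ (+ suc n)                                 ≡⟨ add-sub (d₂ (+ n)) (d₂ (+ suc n)) ⟩
  d₂ (+ n) + d₂ (+ suc n) - d₂ (+ n)           ≡⟨ cong (λ x → d₂ (+ n) + d₂ (+ suc n) - d₂ x) (ℤ.+-identityʳ (+ n)) ⟨
  d₂ (+ n) + d₂ (+ suc n) - d₂ (+ n - + 0)     ∎
  where
  open ≡-Reasoning
  add-sub : ∀ a b → b ≡ a + b - a
  add-sub = solve-∀
δ-step (suc l) n = begin
  δ l (+ 2 * + suc n) + d (+ 2 * + suc n - + 2 * + suc l)
    ≡⟨ cong₂ _+_ (δ-step l n) (cong d (double-sub (+ 1 + + n) (+ 1 + + l))) ⟩
  δ l (+ 2 * + n) + d₂ (+ suc n) - d₂ (+ n - + l) + d₂ (+ 1 + + n - (+ 1 + + l))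
    ≡⟨ cong (λ x → δ l (+ 2 * + n) + d₂ (+ suc n) - d₂ (+ n - + l) + d₂ x) (sub-suc (+ n) (+ l)) ⟩
  δ l (+ 2 * + n) + d₂ (+ suc n) - d₂ (+ n - + l) + d₂ (+ n - + l)
    ≡⟨ regroup (δ l (+ 2 * + n)) (d₂ (+ suc n)) (d₂ (+ n - + l)) (d₂ (+ n - + suc l)) ⟩
  δ l (+ 2 * + n) + d₂ (+ n - + suc l) + d₂ (+ suc n) - d₂ (+ n - + suc l)
    ≡⟨ cong (λ x → δ l (+ 2 * + n) + d x + d₂ (+ suc n) - d₂ (+ n - + suc l)) (double-sub (+ n) (+ suc l)) ⟨
  δ l (+ 2 * + n) + d (+ 2 * + n - + 2 * + suc l) + d₂ (+ suc n) - d₂ (+ n - + suc l)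
    ∎
  where
  open ≡-Reasoning
  double-sub : ∀ a b → + 2 * a - + 2 * b ≡ + 2 * (a - b)
  double-sub = solve-∀
  sub-suc : ∀ a b → + 1 + a - (+ 1 + b) ≡ a - b
  sub-suc = solve-∀
  regroup : ∀ a b c e → a + b - c + c ≡ a + e + b - e
  regroup = solve-∀

d[l+1·2n]≡d₂[l+1·n] : ∀ l n → d (+ suc l * (+ 2 * + n)) ≡ d₂ (+ (suc l ℕ.* n))
d[l+1·2n]≡d₂[l+1·n] l n = cong d (begin
  + suc l * (+ 2 * + n)    ≡⟨ *-swap (+ suc l) (+ n) ⟩
  + 2 * (+ suc l * + n)    ≡⟨ cong (+ 2 *_) (ℤ.pos-* (suc l) n) ⟨
  + 2 * + (suc l ℕ.* n)    ∎)
  where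
  open ≡-Reasoning
  *-swap : ∀ a b → a * (+ 2 * b) ≡ + 2 * (a * b)
  *-swap = solve-∀

K-suc : ∀ l n → K l (suc n) ≡ K l n + Δ l n
K-suc l n = begin
  d (+ suc l * (+ 2 * + suc n)) - δ l (+ 2 * + suc n)
    ≡⟨ cong₂ _-_ (d[l+1·2n]≡d₂[l+1·n] l (suc n)) (δ-step l n) ⟩
  d₂ (+ (suc l ℕ.* suc n)) - (δ l (+ 2 * + n) + d₂ (+ suc n) - d₂ (+ n - + l))
    ≡⟨ regroup (d₂ (+ (suc l ℕ.* suc n))) (δ l (+ 2 * + n)) (d₂ (+ suc n)) (d₂ (+ n - + l)) (d₂ (+ (suc l ℕ.* n))) ⟩
  d₂ (+ (suc l ℕ.* n)) - δ l (+ 2 * + n) + Δ l n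
    ≡⟨ cong (λ x → x - δ l (+ 2 * + n) + Δ l n) (d[l+1·2n]≡d₂[l+1·n] l n) ⟨
  K l n + Δ l n
    ∎
  where
  open ≡-Reasoning
  regroup : ∀ a s b c x → a - (s + b - c) ≡ x - s + (a - x - b + c)
  regroup = solve-∀

K-zero : ∀ l → K l 0 ≡ + 0
K-zero l = cong₂ (λ x y → d x - y) (ℤ.*-zeroʳ (+ suc l)) (δ-nonPos l (+≤+ z≤n))

κ-negative : ∀ l k → κ l (+ 2 * -[1+ k ]) ≡ + 0
κ-negative l k = cong (_-_ (+ 0)) (δ-nonPos l -≤+)

6Δ-expand : ∀ l n → + 6 * Δ l n ≡
  (+ (suc l ℕ.* suc n) + ρ (suc l ℕ.* suc n)) - (+ (suc l ℕ.* n) + ρ (suc l ℕ.* n))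
    - (+ suc n + ρ (suc n)) + + 6 * d₂ (+ n - + l)
6Δ-expand l n = begin
  + 6 * Δ l n
    ≡⟨ distrib (d₂ (+ a)) (d₂ (+ b)) (d₂ (+ suc n)) (d₂ (+ n - + l)) ⟩
  + 6 * d₂ (+ a) - + 6 * d₂ (+ b) - + 6 * d₂ (+ suc n) + + 6 * d₂ (+ n - + l)
    ≡⟨ cong₂ (λ x y → x - y - + 6 * d₂ (+ suc n) + + 6 * d₂ (+ n - + l)) (6d₂[n]≡n+ρ[n] a) (6d₂[n]≡n+ρ[n] b) ⟩
  (+ a + ρ a) - (+ b + ρ b) - + 6 * d₂ (+ suc n) + + 6 * d₂ (+ n - + l)
    ≡⟨ cong (λ x → (+ a + ρ a) - (+ b + ρ b) - x + + 6 * d₂ (+ n - + l)) (6d₂[n]≡n+ρ[n] (suc n)) ⟩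
  (+ a + ρ a) - (+ b + ρ b) - (+ suc n + ρ (suc n)) + + 6 * d₂ (+ n - + l)
    ∎
  where
  open ≡-Reasoning
  a = suc l ℕ.* suc n
  b = suc l ℕ.* n
  distrib : ∀ a b c e → + 6 * (a - b - c + e) ≡ + 6 * a - + 6 * b - + 6 * c + + 6 * e
  distrib = solve-∀

cancel-linear : ∀ {a b c t u} → a ℕ.+ t ≡ b ℕ.+ c ℕ.+ u → ∀ p q r s →
  (+ a + p) - (+ b + q) - (+ c + r) + (+ t + s) ≡ + u + (p - q - r + s)
cancel-linear {a} {b} {c} {t} {u} eq p q r s = begin
  (+ a + p) - (+ b + q) - (+ c + r) + (+ t + s)
    ≡⟨ split (+ a) (+ b) (+ c) (+ t) (+ u) p q r s ⟩
  (+ a + + t) - (+ b + + c + + u) + (+ u + (p - q - r + s))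
    ≡⟨ cong (λ x → x - (+ b + + c + + u) + (+ u + (p - q - r + s))) (cong +_ eq) ⟩
  (+ b + + c + + u) - (+ b + + c + + u) + (+ u + (p - q - r + s))
    ≡⟨ cancel (+ b + + c + + u) (+ u + (p - q - r + s)) ⟩
  + u + (p - q - r + s)
    ∎
  where
  open ≡-Reasoning
  split : ∀ a b c t u p q r s →
    (a + p) - (b + q) - (c + r) + (t + s) ≡ (a + t) - (b + c + u) + (u + (p - q - r + s))
  split = solve-∀
  cancel : ∀ x y → x - x + y ≡ y
  cancel = solve-∀

ρ-cong : ∀ {a b} → a ≡ b [mod 6 ] → ρ a ≡ ρ b
ρ-cong (residues a≡b) = cong ρ₆ a≡b

on-residues₆ : (P : ℕ → ℕ → Set) → (∀ (r s : Fin 6) → P (toℕ r) (toℕ s)) → ∀ a b → P (a % 6) (b % 6)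
on-residues₆ P holds a b = subst₂ P (toℕ-fromℕ< _) (toℕ-fromℕ< _) (holds (a mod 6) (b mod 6))

ρ-stable : ℕ → ℕ → ℤ
ρ-stable l t = ρ (suc l ℕ.* suc (l ℕ.+ t)) - ρ (suc l ℕ.* (l ℕ.+ t)) - ρ (suc (l ℕ.+ t)) + ρ t

ρ-stable-mod : ∀ l t → ρ-stable l t ≡ ρ-stable (l % 6) (t % 6)
ρ-stable-mod l t = cong₂ _+_ (cong₂ _-_ (cong₂ _-_ (ρ-cong first) (ρ-cong second)) (ρ-cong third)) (ρ-cong T)
  where
  r = l % 6
  s = t % 6
  L : l ≡ r [mod 6 ]
  L = ≡-mod-reduce l
  T : t ≡ s [mod 6 ]
  T = ≡-mod-reduce t
  first : suc l ℕ.* suc (l ℕ.+ t) ≡ suc r ℕ.* suc (r ℕ.+ s) [mod 6 ]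
  first = *-cong-mod (suc-cong-mod L) (suc-cong-mod (+-cong-mod L T))
  second : suc l ℕ.* (l ℕ.+ t) ≡ suc r ℕ.* (r ℕ.+ s) [mod 6 ]
  second = *-cong-mod (suc-cong-mod L) (+-cong-mod L T)
  third : suc (l ℕ.+ t) ≡ suc (r ℕ.+ s) [mod 6 ]
  third = suc-cong-mod (+-cong-mod L T)

ρ-stable≡0 : ∀ l t → ρ-stable l t ≡ + 0
ρ-stable≡0 l t = trans (ρ-stable-mod l t) (on-residues₆ (λ r s → ρ-stable r s ≡ + 0) table l t)
  where
  table : ∀ (r s : Fin 6) → ρ-stable (toℕ r) (toℕ s) ≡ + 0
  table = from-yes (all? λ (r : Fin 6) → all? λ (s : Fin 6) → ρ-stable (toℕ r) (toℕ s) ℤ.≟ + 0)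

Δ-above-diagonal : ∀ l t → Δ l (l ℕ.+ t) ≡ + 0
Δ-above-diagonal l t = ℤ.*-cancelˡ-≡ (+ 6) (Δ l n) (+ 0) (begin
  + 6 * Δ l n
    ≡⟨ 6Δ-expand l n ⟩
  (+ a + ρ a) - (+ b + ρ b) - (+ suc n + ρ (suc n)) + + 6 * d₂ (+ n - + l)
    ≡⟨ cong (λ x → (+ a + ρ a) - (+ b + ρ b) - (+ suc n + ρ (suc n)) + + 6 * d₂ x) (add-sub (+ l) (+ t)) ⟩
  (+ a + ρ a) - (+ b + ρ b) - (+ suc n + ρ (suc n)) + + 6 * d₂ (+ t)
    ≡⟨ cong (_+_ ((+ a + ρ a) - (+ b + ρ b) - (+ suc n + ρ (suc n)))) (6d₂[n]≡n+ρ[n] t) ⟩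
  (+ a + ρ a) - (+ b + ρ b) - (+ suc n + ρ (suc n)) + (+ t + ρ t)
    ≡⟨ cancel-linear (linear l t) (ρ a) (ρ b) (ρ (suc n)) (ρ t) ⟩
  + 0 + ρ-stable l t
    ≡⟨ ℤ.+-identityˡ (ρ-stable l t) ⟩
  ρ-stable l t
    ≡⟨ ρ-stable≡0 l t ⟩
  + 0 ∎)
  where
  open ≡-Reasoning
  n = l ℕ.+ t
  a = suc l ℕ.* suc n
  b = suc l ℕ.* n
  add-sub : ∀ x y → x + y - x ≡ y
  add-sub = solve-∀
  linear : ∀ l t → suc l ℕ.* suc (l ℕ.+ t) ℕ.+ t ≡ suc l ℕ.* (l ℕ.+ t) ℕ.+ suc (l ℕ.+ t) ℕ.+ 0
  linear = ℕ-Solver.solve-∀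

ρ-rising : ℕ → ℕ → ℤ
ρ-rising m k = ρ (suc (suc (m ℕ.+ k)) ℕ.* suc m) - ρ (suc (suc (m ℕ.+ k)) ℕ.* m) - ρ (suc m)

ρ-rising-mod : ∀ m k → ρ-rising m k ≡ ρ-rising (m % 6) (k % 6)
ρ-rising-mod m k = cong₂ _-_ (cong₂ _-_ (ρ-cong first) (ρ-cong second)) (ρ-cong (suc-cong-mod M))
  where
  r = m % 6
  s = k % 6
  M : m ≡ r [mod 6 ]
  M = ≡-mod-reduce m
  T : k ≡ s [mod 6 ]
  T = ≡-mod-reduce k
  first : suc (suc (m ℕ.+ k)) ℕ.* suc m ≡ suc (suc (r ℕ.+ s)) ℕ.* suc r [mod 6 ]
  first = *-cong-mod (suc-cong-mod (suc-cong-mod (+-cong-mod M T))) (suc-cong-mod M)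
  second : suc (suc (m ℕ.+ k)) ℕ.* m ≡ suc (suc (r ℕ.+ s)) ℕ.* r [mod 6 ]
  second = *-cong-mod (suc-cong-mod (suc-cong-mod (+-cong-mod M T))) M

ρ-rising-bounds : ∀ m k → (-[1+ 5 ] ≤ℤ ρ-rising m k) × (ρ-rising m k ≤ℤ + 1)
ρ-rising-bounds m k = subst Bounded (sym (ρ-rising-mod m k))
  (on-residues₆ (λ r s → Bounded (ρ-rising r s)) table m k)
  where
  Bounded : ℤ → Set
  Bounded x = (-[1+ 5 ] ≤ℤ x) × (x ≤ℤ + 1)
  table : ∀ (r s : Fin 6) → Bounded (ρ-rising (toℕ r) (toℕ s))
  table = from-yes (all? λ (r : Fin 6) → all? λ (s : Fin 6) →
    (-[1+ 5 ] ℤ.≤? ρ-rising (toℕ r) (toℕ s)) ×-dec (ρ-rising (toℕ r) (toℕ s) ℤ.≤? + 1))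

6Δ-below-diagonal : ∀ n k → + 6 * Δ (suc (n ℕ.+ k)) n ≡ + suc k + ρ-rising n k
6Δ-below-diagonal n k = begin
  + 6 * Δ l n
    ≡⟨ 6Δ-expand l n ⟩
  (+ a + ρ a) - (+ b + ρ b) - (+ suc n + ρ (suc n)) + + 6 * d₂ (+ n - + l)
    ≡⟨ cong (λ x → (+ a + ρ a) - (+ b + ρ b) - (+ suc n + ρ (suc n)) + + 6 * d₂ x) (sub-add (+ n) (+ k)) ⟩
  (+ a + ρ a) - (+ b + ρ b) - (+ suc n + ρ (suc n)) + (+ 0 + + 0)
    ≡⟨ cancel-linear (linear n k) (ρ a) (ρ b) (ρ (suc n)) (+ 0) ⟩
  + suc k + (ρ-rising n k + + 0)
    ≡⟨ cong (_+_ (+ suc k)) (ℤ.+-identityʳ (ρ-rising n k)) ⟩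
  + suc k + ρ-rising n k ∎
  where
  open ≡-Reasoning
  l = suc (n ℕ.+ k)
  a = suc l ℕ.* suc n
  b = suc l ℕ.* n
  sub-add : ∀ x y → x - (+ 1 + (x + y)) ≡ - (+ 1 + y)
  sub-add = solve-∀
  linear : ∀ n k → suc (suc (n ℕ.+ k)) ℕ.* suc n ℕ.+ 0 ≡ suc (suc (n ℕ.+ k)) ℕ.* n ℕ.+ suc n ℕ.+ suc k
  linear = ℕ-Solver.solve-∀

Δ-vanishes : ∀ {l n} → l ≤ n → Δ l n ≡ + 0
Δ-vanishes {l} {n} l≤n = subst (λ m → Δ l m ≡ + 0) (ℕ.m+[n∸m]≡n l≤n) (Δ-above-diagonal l (n ℕ.∸ l))

Δ-bounds-above-diagonal : ∀ {l n} → l ≤ n → (+ 0 ≤ℤ Δ l n) × (+ 6 * Δ l n ≤ℤ + suc l)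
Δ-bounds-above-diagonal {l} l≤n =
  subst (λ x → (+ 0 ≤ℤ x) × (+ 6 * x ≤ℤ + suc l)) (sym (Δ-vanishes l≤n)) (+≤+ z≤n , +≤+ z≤n)

Δ-bounds-below-diagonal : ∀ n k → let l = suc (n ℕ.+ k) in (+ 0 ≤ℤ Δ l n) × (+ 6 * Δ l n ≤ℤ + suc l)
Δ-bounds-below-diagonal n k = nonNeg , subst (_≤ℤ + suc l) (sym 6Δ≡) upper
  where
  l = suc (n ℕ.+ k)
  6Δ≡ = 6Δ-below-diagonal n k
  bounds = ρ-rising-bounds n k
  -- 6Δ > -6 is enough because 6Δ is a multiple of 6.
  nonNeg : + 0 ≤ℤ Δ l n
  nonNeg = ℤ.i<j⇒suc[i]≤j { -[1+ 0 ]} (ℤ.*-cancelˡ-<-nonNeg (+ 6) (subst (-[1+ 5 ] <ℤ_) (sym 6Δ≡)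
    (ℤ.<-≤-trans (-<- (ℕ.n<1+n 4)) (ℤ.+-mono-≤ (+≤+ (s≤s z≤n)) (proj₁ bounds)))))
  upper : + suc k + ρ-rising n k ≤ℤ + suc l
  upper = ℤ.≤-trans (ℤ.+-monoʳ-≤ (+ suc k) (proj₂ bounds))
    (+≤+ (s≤s (subst (ℕ._≤ suc (n ℕ.+ k)) (ℕ.+-comm 1 k) (s≤s (ℕ.m≤n+m k n)))))

Δ-bounds : ∀ l n → (+ 0 ≤ℤ Δ l n) × (+ 6 * Δ l n ≤ℤ + suc l)
Δ-bounds l n with compare n l
... | less n k    = Δ-bounds-below-diagonal n k
... | equal l     = Δ-bounds-above-diagonal ℕ.≤-refl
... | greater l k = Δ-bounds-above-diagonal (ℕ.m≤n⇒m≤1+n (ℕ.m≤m+n l k))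

K-nonDecreasing : ∀ l {m n} → m ≤ n → K l m ≤ℤ K l n
K-nonDecreasing l = Increments.nonDecreasing (K l) (Δ l) (K-suc l) (λ n → proj₁ (Δ-bounds l n))

K-nonNeg : ∀ l n → + 0 ≤ℤ K l n
K-nonNeg l n = subst (_≤ℤ K l n) (K-zero l) (K-nonDecreasing l {0} {n} z≤n)

K-stable : ∀ l {n} → l ≤ n → K l n ≡ K l l
K-stable l = Increments.constantFrom (K l) (Δ l) (K-suc l) Δ-vanishes

6K[l]≤[3+l][4+l] : ∀ l → + 6 * K l l ≤ℤ (+ 3 + + l) * (+ 4 + + l)
6K[l]≤[3+l][4+l] l = begin
  + 6 * K l l                       ≤⟨ Increments.boundedBy (λ n → + 6 * K l n) (λ n → + 6 * Δ l n) 6K-suc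
                                         (λ n → proj₂ (Δ-bounds l n)) l ⟩
  + 6 * K l 0 + + l * + suc l       ≡⟨ cong₂ (λ x y → + 6 * x + y) (K-zero l) (sym (ℤ.pos-* l (suc l))) ⟩
  + 0 + + (l ℕ.* suc l)             ≤⟨ +≤+ (ℕ.*-mono-≤ (ℕ.m≤n+m l 3) (ℕ.m≤n+m (suc l) 3)) ⟩
  + ((3 ℕ.+ l) ℕ.* (4 ℕ.+ l))       ∎
  where
  open ℤ.≤-Reasoning
  6K-suc : ∀ n → + 6 * K l (suc n) ≡ + 6 * K l n + + 6 * Δ l n
  6K-suc n = trans (cong (+ 6 *_) (K-suc l n)) (ℤ.*-distribˡ-+ (+ 6) (K l n) (Δ l n))

K-small : ∀ l → l ≤ 4 → K l l ≡ + 0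
K-small 0 _ = refl
K-small 1 _ = refl
K-small 2 _ = refl
K-small 3 _ = refl
K-small 4 _ = refl
K-small (suc (suc (suc (suc (suc _))))) (s≤s (s≤s (s≤s (s≤s ()))))

κ-nonNeg : ∀ l m → + 0 ≤ℤ m → + 0 ≤ℤ κ l (+ 2 * m)
κ-nonNeg l (+ n) _ = K-nonNeg l n

κ-nonDecreasing : ∀ l m → + 0 ≤ℤ m → κ l (+ 2 * m) ≤ℤ κ l (+ 2 * (m + + 1))
κ-nonDecreasing l (+ n) _ = K-nonDecreasing l {n} {n ℕ.+ 1} (ℕ.m≤m+n n 1)

κ-eventually : ∀ l m → + 2 * + l + + 12 ≤ℤ + 2 * m → κ l (+ 2 * m) ≡ K l l
κ-eventually l (+ n) h = K-stable l (ℤ.drop‿+≤+ (ℤ.*-cancelˡ-≤-pos (+ l) (+ n) (+ 2)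
  (ℤ.≤-trans (ℤ.i≤i+j (+ 2 * + l) (+ 12)) h)))
κ-eventually l -[1+ k ] h with ℤ.≤-trans (subst (λ x → + 0 ≤ℤ x + + 12) (ℤ.pos-* 2 l) (+≤+ z≤n)) h
... | ()

κ-vanishing : ∀ l → K l l ≡ + 0 → ∀ m → κ l (+ 2 * m) ≡ + 0
κ-vanishing l K≡0 -[1+ k ] = κ-negative l k
κ-vanishing l K≡0 (+ n) with l ℕ.≤? n
... | yes l≤n = trans (K-stable l l≤n) K≡0
... | no  l≰n = ℤ.≤-antisym
  (subst (K l n ≤ℤ_) K≡0 (K-nonDecreasing l {n} {l} (ℕ.<⇒≤ (ℕ.≰⇒> l≰n)))) (K-nonNeg l n)

lemma1 : (l : ℕ) →
    ((m : ℤ) → + 0 ≤ℤ m → + 0 ≤ℤ κ l (+ 2 * m))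
    × ((m : ℤ) → + 0 ≤ℤ m → κ l (+ 2 * m) ≤ℤ κ l (+ 2 * (m + + 1)))
    × ∃ (λ (k : ℤ) →
        (+ 0 ≤ℤ k)
        × (+ 6 * k ≤ℤ (+ 3 + + l) * (+ 4 + + l))
        × ((m : ℤ) → + 2 * + l + + 12 ≤ℤ + 2 * m → κ l (+ 2 * m) ≡ k)
        × (l ≤ 4 → (k ≡ + 0) × ((m : ℤ) → κ l (+ 2 * m) ≡ + 0)))
lemma1 l =
  κ-nonNeg l , κ-nonDecreasing l ,
  K l l , K-nonNeg l l , 6K[l]≤[3+l][4+l] l , κ-eventually l ,
  λ l≤4 → K-small l l≤4 , κ-vanishing l (K-small l l≤4)
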